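{- For every integer $n\ge 2$, the doubled odd graph $\mathrm{DO}_n$ admits a perfect $1$-code if and only if the odd graph $\mathrm{O}_n$ admits a perfect $1$-code.
   Context: Let $S$ be a set of size $2n-1$. The odd graph $\mathrm{O}_n$ has as vertices the $(n-1)$-subsets of $S$, two being adjacent when disjoint. The doubled odd graph $\mathrm{DO}_n$ has as vertices the $(n-1)$-subsets and the $n$-subsets of $S$, an $(n-1)$-subset being adjacent to an $n$-subset when it is contained in it. A perfect $1$-code in a graph is a vertex subset $C$ such that the closed neighbourhoods of the vertices of $C$ partition the vertex set. -}

module Defs where

open import Data.Nat using (ℕ; _∸_; _*_)
open import Data.Fin.Subset using (Subset; ∣_∣; _∩_; ⊥; _⊆_)
open import Data.Product using (Σ; ∃; _×_)
open import Data.Sum using (_⊎_)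
open import Relation.Binary.PropositionalEquality using (_≡_)

record Graph : Set₁ where
  field
    V   : Set
    Adj : V → V → Set
open Graph public

InClosedNbhd : (G : Graph) → V G → V G → Set
InClosedNbhd G c u = c ≡ u ⊎ Adj G c u

IsPerfect1Code : (G : Graph) → (V G → Set) → Set
IsPerfect1Code G C =
  ((u : V G) → ∃ λ c → C c × InClosedNbhd G c u)
  × ((c c′ u : V G) → C c → C c′ → InClosedNbhd G c u → InClosedNbhd G c′ u → c ≡ c′)

HasPerfect1Code : Graph → Set₁
HasPerfect1Code G = ∃ λ (C : V G → Set) → IsPerfect1Code G C

ground : ℕ → ℕ
ground n = 2 * n ∸ 1

OddGraph : ℕ → Graph
OddGraph n = record
  { V   = Σ (Subset (ground n)) (λ p → ∣ p ∣ ≡ n ∸ 1)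
  ; Adj = λ p q → (Σ.proj₁ p ∩ Σ.proj₁ q) ≡ ⊥
  }

DoubledOddGraph : ℕ → Graph
DoubledOddGraph n = record
  { V   = Σ (Subset (ground n)) (λ p → ∣ p ∣ ≡ n ∸ 1 ⊎ ∣ p ∣ ≡ n)
  ; Adj = λ p q →
      (∣ Σ.proj₁ p ∣ ≡ n ∸ 1 × ∣ Σ.proj₁ q ∣ ≡ n × Σ.proj₁ p ⊆ Σ.proj₁ q)
    ⊎ (∣ Σ.proj₁ q ∣ ≡ n ∸ 1 × ∣ Σ.proj₁ p ∣ ≡ n × Σ.proj₁ q ⊆ Σ.proj₁ p)
  }

-- A perfect code of O_n lifts to one of its bipartite double O_n × K₂ (take both copies), and
-- DO_n ≅ O_n × K₂ by replacing every n-set with its complement.  Conversely, a perfect code of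
-- O_n × K₂ consists of two families A, C of k-subsets (k = n − 1) of a (2k+1)-set such that
-- every k-set lies in A or is disjoint from exactly one member of C, and vice versa; it suffices
-- to show A = C.  Summing these equations over the k + 2 one-point extensions of a (k−1)-set x
-- gives #{a ∈ A : x ⊆ a} + 2·#{c ∈ C : c ∩ x = ∅} = k + 2, where the first count is at most 1.
-- For even k this forces A = ∅ = C, contradicting the equations.  For odd k it shows that A and C
-- contain each (k−1)-set equally often; by inclusion–exclusion they then agree on every pattern
-- "contains I, avoids E" with |I| + |E| < k, and for |I| + |E| = k their difference changes sign
-- whenever an avoided point becomes a contained one.  Comparing "avoids y" with "contains y" for a
-- k-set y (k sign changes, k odd) with the two equations at y yields A = C.

module Submission where

open import Defs
open import Data.Nat using (ℕ; zero; suc; _+_; _*_; _∸_; _≤_; z≤n; s≤s)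
open import Data.Nat.Properties
open import Data.Nat.DivMod using (_%_; m≤n⇒m%n≡m; [m+kn]%n≡m%n)
open import Data.Nat.Solver using (module +-*-Solver)
open import Data.Bool using (Bool; true; false; not; _∧_; _∨_; if_then_else_)
open import Data.Bool.Properties using (∧-conicalˡ; ∧-conicalʳ; ∧-zeroʳ; ∧-identityʳ; not-¬; not-involutive; not-injective)
open import Data.Fin using (Fin; zero; suc)
import Data.Fin.Properties as Fin
open import Data.Vec using (Vec; []; _∷_; lookup; map; replicate; _[_]≔_; here)
open import Data.Vec.Properties using (∷-injectiveˡ; ∷-injectiveʳ; lookup-map; map-[]≔; lookup∘update; lookup∘update′; []≔-commutes; []≔-idempotent; []≔-lookup; map-∘; map-cong; map-id)
open import Data.Fin.Subset using (Subset; ∣_∣; ∁; _⊆_; _∩_; ⊥; inside; outside)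
open import Data.Fin.Subset.Properties using (drop-∷-⊆; out⊆; s⊆s; p⊆q⇒∣p∣≤∣q∣; ∣∁p∣≡n∸∣p∣; ∩-idem; ∩-comm; ∣⊥∣≡0)
open import Data.Empty using () renaming (⊥ to Empty; ⊥-elim to absurd)
open import Data.Product using (∃; _×_; _,_; proj₁; proj₂)
open import Data.Sum using (_⊎_; inj₁; inj₂)
open import Function using (_∘_; case_of_)
open import Relation.Nullary using (¬_; Dec; yes; no; does)
open import Relation.Binary.Definitions using (DecidableEquality)
open import Relation.Binary.PropositionalEquality
open import Algebra.Properties.CommutativeSemigroup +-commutativeSemigroup using (interchange)
open import Algebra.Properties.Semiring.Sum +-*-semiring using (sum-syntax; sum-cong-≗; sum-replicate-zero; ∑-distrib-+; *-distribˡ-sum)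

open +-*-Solver

private
  variable
    m : ℕ

-- Perfect codes and bipartite doubles

BipartiteDouble : Graph → Graph
BipartiteDouble G = record
  { V   = V G × Bool
  ; Adj = λ x y → Adj G (proj₁ x) (proj₁ y) × proj₂ y ≡ not (proj₂ x)
  }

Loopless : Graph → Set
Loopless G = ∀ v → ¬ Adj G v v

BipartiteDouble-loopless : ∀ G → Loopless (BipartiteDouble G)
BipartiteDouble-loopless G (v , b) (_ , b≡not-b) = not-¬ {b} refl b≡not-b

record _≅_ (G H : Graph) : Set where
  field
    to       : V G → V H
    from     : V H → V G
    from∘to  : ∀ v → from (to v) ≡ v
    to∘from  : ∀ w → to (from w) ≡ w
    to-adj   : ∀ {u v} → Adj G u v → Adj H (to u) (to v)
    from-adj : ∀ {x y} → Adj H x y → Adj G (from x) (from y)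

≅-sym : ∀ {G H} → G ≅ H → H ≅ G
≅-sym iso = record { to = from ; from = to ; from∘to = to∘from ; to∘from = from∘to ; to-adj = from-adj ; from-adj = to-adj }
  where open _≅_ iso

transfer : ∀ {G H} → G ≅ H → HasPerfect1Code G → HasPerfect1Code H
transfer {G} {H} iso (C , cover , unique) = (C ∘ from) , cover′ , unique′
  where
  open _≅_ iso
  to-nbhd : ∀ {c u} → InClosedNbhd G c u → InClosedNbhd H (to c) (to u)
  to-nbhd (inj₁ c≡u) = inj₁ (cong to c≡u)
  to-nbhd (inj₂ adj) = inj₂ (to-adj adj)
  from-nbhd : ∀ {c u} → InClosedNbhd H c u → InClosedNbhd G (from c) (from u)
  from-nbhd (inj₁ c≡u) = inj₁ (cong from c≡u)
  from-nbhd (inj₂ adj) = inj₂ (from-adj adj)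
  cover′ : ∀ w → ∃ λ c → C (from c) × InClosedNbhd H c w
  cover′ w = let c , Cc , c∼w = cover (from w)
             in to c , subst C (sym (from∘to c)) Cc , subst (InClosedNbhd H (to c)) (to∘from w) (to-nbhd c∼w)
  unique′ : ∀ c c′ w → C (from c) → C (from c′) → InClosedNbhd H c w → InClosedNbhd H c′ w → c ≡ c′
  unique′ c c′ w Cc Cc′ c∼w c′∼w =
    trans (sym (to∘from c)) (trans (cong to (unique _ _ _ Cc Cc′ (from-nbhd c∼w) (from-nbhd c′∼w))) (to∘from c′))

perfect-code-decidable : ∀ {G C} → Loopless G → IsPerfect1Code G C → ∀ v → Dec (C v)
perfect-code-decidable {G} {C} loopless (cover , unique) v with cover v
... | c , Cc , inj₁ c≡v = yes (subst C c≡v Cc)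
... | c , Cc , inj₂ adj = no λ Cv → loopless v (subst (λ w → Adj G w v) (unique c v v Cc Cv (inj₂ adj) (inj₁ refl)) adj)

lift-code : ∀ {G} → Loopless G → HasPerfect1Code G → HasPerfect1Code (BipartiteDouble G)
lift-code {G} loopless (C , cover , unique) = (C ∘ proj₁) , cover′ , unique′
  where
  G² : Graph
  G² = BipartiteDouble G
  cover′ : ∀ w → ∃ λ c → C (proj₁ c) × InClosedNbhd G² c w
  cover′ (u , a) with cover u
  ... | c , Cc , inj₁ c≡u = (c , a) , Cc , inj₁ (cong (_, a) c≡u)
  ... | c , Cc , inj₂ adj = (c , not a) , Cc , inj₂ (adj , sym (not-involutive a))
  down : ∀ {c w} → InClosedNbhd G² c w → InClosedNbhd G (proj₁ c) (proj₁ w)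
  down (inj₁ c≡w)     = inj₁ (cong proj₁ c≡w)
  down (inj₂ (adj , _)) = inj₂ adj
  unique′ : ∀ c c′ w → C (proj₁ c) → C (proj₁ c′) → InClosedNbhd G² c w → InClosedNbhd G² c′ w → c ≡ c′
  unique′ (c , x) (c′ , x′) (u , a) Cc Cc′ c∼w c′∼w = cong₂ _,_ c≡c′ (sides c∼w c′∼w)
    where
    c≡c′ : c ≡ c′
    c≡c′ = unique c c′ u Cc Cc′ (down c∼w) (down c′∼w)
    sides : InClosedNbhd G² (c , x) (u , a) → InClosedNbhd G² (c′ , x′) (u , a) → x ≡ x′
    sides (inj₁ e)         (inj₁ e′)         = trans (cong proj₂ e) (sym (cong proj₂ e′))
    sides (inj₂ (_ , a≡))  (inj₂ (_ , a≡′))  = not-injective (trans (sym a≡) a≡′)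
    sides (inj₁ e)         (inj₂ (adj′ , _)) =
      absurd (loopless u (subst (λ w → Adj G w u) (trans (sym c≡c′) (cong proj₁ e)) adj′))
    sides (inj₂ (adj , _)) (inj₁ e′)         =
      absurd (loopless u (subst (λ w → Adj G w u) (trans c≡c′ (cong proj₁ e′)) adj))

project-code : ∀ {G} (D : V (BipartiteDouble G) → Set) → IsPerfect1Code (BipartiteDouble G) D →
  (∀ v b → D (v , b) → D (v , not b)) → HasPerfect1Code G
project-code {G} D (cover , unique) swap-inv = (λ v → D (v , false)) , cover′ , unique′
  where
  G² : Graph
  G² = BipartiteDouble G
  cover′ : ∀ u → ∃ λ c → D (c , false) × InClosedNbhd G c u
  cover′ u with cover (u , false)
  ... | (c , b) , Dc , inj₁ c≡u = c , subst (λ x → D (c , x)) (cong proj₂ c≡u) Dc , inj₁ (cong proj₁ c≡u)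
  ... | (c , b) , Dc , inj₂ (adj , false≡not-b) = c , subst (λ x → D (c , x)) (sym false≡not-b) (swap-inv c b Dc) , inj₂ adj
  up : ∀ {c u} → D (c , false) → InClosedNbhd G c u → ∃ λ x → D (c , x) × InClosedNbhd G² (c , x) (u , false)
  up Dc (inj₁ c≡u) = false , Dc , inj₁ (cong (_, false) c≡u)
  up {c} Dc (inj₂ adj) = true , swap-inv c false Dc , inj₂ (adj , refl)
  unique′ : ∀ c c′ u → D (c , false) → D (c′ , false) → InClosedNbhd G c u → InClosedNbhd G c′ u → c ≡ c′
  unique′ c c′ u Dc Dc′ c∼u c′∼u =
    let x , Dcx , cx∼u = up Dc c∼u
        x′ , Dcx′ , cx′∼u = up Dc′ c′∼u
    in cong proj₁ (unique (c , x) (c′ , x′) (u , false) Dcx Dcx′ cx∼u cx′∼u)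

+⇒∸ : ∀ {a b c} → a + b ≡ c → a ≡ c ∸ b
+⇒∸ {a} {b} e = trans (sym (m+n∸n≡m a b)) (cong (_∸ b) e)

bit-unique : ∀ {a b} x y → a ≤ 1 → b ≤ 1 → a + 2 * x ≡ b + 2 * y → a ≡ b
bit-unique {a} {b} x y a≤1 b≤1 e = begin
  a               ≡⟨ m≤n⇒m%n≡m a≤1 ⟨
  a % 2           ≡⟨ [m+kn]%n≡m%n a x 2 ⟨
  (a + x * 2) % 2 ≡⟨ cong (λ w → (a + w) % 2) (*-comm x 2) ⟩
  (a + 2 * x) % 2 ≡⟨ cong (_% 2) e ⟩
  (b + 2 * y) % 2 ≡⟨ cong (λ w → (b + w) % 2) (*-comm 2 y) ⟩
  (b + y * 2) % 2 ≡⟨ [m+kn]%n≡m%n b y 2 ⟩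
  b % 2           ≡⟨ m≤n⇒m%n≡m b≤1 ⟩
  b               ∎
  where open ≡-Reasoning

parity : ∀ n → (∃ λ i → n ≡ i * 2) ⊎ (∃ λ i → n ≡ suc (i * 2))
parity zero = inj₁ (0 , refl)
parity (suc n) with parity n
... | inj₁ (i , n≡) = inj₂ (i , cong suc n≡)
... | inj₂ (i , n≡) = inj₁ (suc i , cong suc n≡)

swap-difference : ∀ a b a′ b′ A B → a + a′ ≡ b + b′ → a′ + B ≡ b′ + A → a + A ≡ b + B
swap-difference a b a′ b′ A B e e′ = +-cancelʳ-≡ (a′ + b′) _ _ (begin
  (a + A) + (a′ + b′) ≡⟨ solve 6 (λ a b a′ b′ A B → (a :+ A) :+ (a′ :+ b′) := (a :+ a′) :+ (b′ :+ A)) refl a b a′ b′ A B ⟩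
  (a + a′) + (b′ + A) ≡⟨ cong₂ _+_ e (sym e′) ⟩
  (b + b′) + (a′ + B) ≡⟨ solve 6 (λ a b a′ b′ A B → (b :+ b′) :+ (a′ :+ B) := (b :+ B) :+ (a′ :+ b′)) refl a b a′ b′ A B ⟩
  (b + B) + (a′ + b′) ∎)
  where open ≡-Reasoning

cross-cancel : ∀ a c p q → a + q ≡ c + p → p + a ≡ q + c → a ≡ c
cross-cancel a c p q e e′ = *-cancelʳ-≡ a c 2 (+-cancelʳ-≡ (p + q) _ _ (begin
  a * 2 + (p + q)       ≡⟨ solve 3 (λ a p q → a :* con 2 :+ (p :+ q) := (a :+ q) :+ (p :+ a)) refl a p q ⟩
  (a + q) + (p + a)     ≡⟨ cong₂ _+_ e e′ ⟩
  (c + p) + (q + c)     ≡⟨ solve 3 (λ c p q → (c :+ p) :+ (q :+ c) := c :* con 2 :+ (p :+ q)) refl c p q ⟩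
  c * 2 + (p + q)       ∎))
  where open ≡-Reasoning

∑-zero : ∀ {n} (g : Fin n → ℕ) → (∀ u → g u ≡ 0) → ∑[ u < n ] g u ≡ 0
∑-zero {n} g g≡0 = trans (sum-cong-≗ g≡0) (sum-replicate-zero n)

∑-≤1 : ∀ {n} (g : Fin n → ℕ) → (∀ u → g u ≤ 1) →
  (∀ u₁ u₂ → u₁ ≢ u₂ → 1 ≤ g u₁ → 1 ≤ g u₂ → Empty) → ∑[ u < n ] g u ≤ 1
∑-≤1 {zero}  g _  _    = z≤n
∑-≤1 {suc n} g ≤1 pair with g zero in g0
... | zero  = ∑-≤1 (λ u → g (suc u)) (λ u → ≤1 (suc u)) λ u₁ u₂ u₁≢u₂ → pair (suc u₁) (suc u₂) (u₁≢u₂ ∘ Fin.suc-injective)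
... | suc a = subst (_≤ 1) (cong (suc a +_) (sym (∑-zero (λ u → g (suc u)) rest)))
                           (≤-trans (≤-reflexive (+-identityʳ _)) (subst (_≤ 1) g0 (≤1 zero)))
  where
  rest : ∀ u → g (suc u) ≡ 0
  rest u with g (suc u) in gu
  ... | zero  = refl
  ... | suc _ = absurd (pair zero (suc u) (λ ()) (subst (1 ≤_) (sym g0) (s≤s z≤n)) (subst (1 ≤_) (sym gu) (s≤s z≤n)))

∨-true : ∀ a b → a ∨ b ≡ true → a ≡ true ⊎ b ≡ true
∨-true true  _ _  = inj₁ refl
∨-true false _ ab = inj₂ ab

⊆-∣∣≤⇒≡ : ∀ {p q : Subset m} → p ⊆ q → ∣ q ∣ ≤ ∣ p ∣ → p ≡ q
⊆-∣∣≤⇒≡ {p = []}          {[]}          _  _       = refl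
⊆-∣∣≤⇒≡ {p = outside ∷ p} {outside ∷ q} pq le      = cong (outside ∷_) (⊆-∣∣≤⇒≡ (drop-∷-⊆ pq) le)
⊆-∣∣≤⇒≡ {p = inside ∷ p}  {inside ∷ q}  pq (s≤s le) = cong (inside ∷_) (⊆-∣∣≤⇒≡ (drop-∷-⊆ pq) le)
⊆-∣∣≤⇒≡ {p = inside ∷ p}  {outside ∷ q} pq _       with pq here
... | ()
⊆-∣∣≤⇒≡ {p = outside ∷ p} {inside ∷ q}  pq le      = absurd (<⇒≱ (s≤s (p⊆q⇒∣p∣≤∣q∣ (drop-∷-⊆ pq))) le)

∁-involutive : ∀ (p : Subset m) → ∁ (∁ p) ≡ p
∁-involutive p = trans (sym (map-∘ not not p)) (trans (map-cong not-involutive p) (map-id p))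

⊆⇒∩∁≡⊥ : ∀ {p q : Subset m} → p ⊆ q → p ∩ ∁ q ≡ ⊥
⊆⇒∩∁≡⊥ {p = []}          {[]}          _  = refl
⊆⇒∩∁≡⊥ {p = outside ∷ p} {b ∷ q}       pq = cong (outside ∷_) (⊆⇒∩∁≡⊥ (drop-∷-⊆ pq))
⊆⇒∩∁≡⊥ {p = inside ∷ p}  {inside ∷ q}  pq = cong (outside ∷_) (⊆⇒∩∁≡⊥ (drop-∷-⊆ pq))
⊆⇒∩∁≡⊥ {p = inside ∷ p}  {outside ∷ q} pq with pq here
... | ()

∩∁≡⊥⇒⊆ : ∀ {p q : Subset m} → p ∩ ∁ q ≡ ⊥ → p ⊆ q
∩∁≡⊥⇒⊆ {p = []}          {[]}          _ = λ ()
∩∁≡⊥⇒⊆ {p = outside ∷ p} {b ∷ q}       e = out⊆ (∩∁≡⊥⇒⊆ (∷-injectiveʳ e))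
∩∁≡⊥⇒⊆ {p = inside ∷ p}  {inside ∷ q}  e = s⊆s (∩∁≡⊥⇒⊆ (∷-injectiveʳ e))
∩∁≡⊥⇒⊆ {p = inside ∷ p}  {outside ∷ q} e with ∷-injectiveˡ e
... | ()

∩≡⊥⇒⊆∁ : ∀ {p q : Subset m} → p ∩ q ≡ ⊥ → p ⊆ ∁ q
∩≡⊥⇒⊆∁ {p = p} {q} e = ∩∁≡⊥⇒⊆ (trans (cong (p ∩_) (∁-involutive q)) e)

-- Counting subsets by patterns

-- A pattern prescribes at each position of a subset membership (incl), non-membership (excl)
-- or nothing (free).
data Mark : Set where
  incl excl free : Mark

Pattern : ℕ → Set
Pattern = Vec Mark

admits : Mark → Bool → Bool
admits incl b = b
admits excl b = not b
admits free _ = true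

fits : Pattern m → Subset m → Bool
fits []      []      = true
fits (t ∷ c) (b ∷ z) = admits t b ∧ fits c z

everything : Pattern m
everything = replicate _ free

sumMark : Mark → (Bool → ℕ) → ℕ
sumMark incl g = g true
sumMark excl g = g false
sumMark free g = g false + g true

sumFitting : Pattern m → (Subset m → ℕ) → ℕ
sumFitting []      h = h []
sumFitting (t ∷ c) h = sumMark t (λ b → sumFitting c (λ z → h (b ∷ z)))

𝟙 : Bool → ℕ
𝟙 true  = 1
𝟙 false = 0

count : (Subset m → Bool) → Pattern m → ℕ
count F c = sumFitting c (λ z → 𝟙 (F z))

fits-∷ : ∀ t b (c : Pattern m) z → admits t b ≡ true → fits c z ≡ true → fits (t ∷ c) (b ∷ z) ≡ true
fits-∷ t b c z = cong₂ _∧_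

fits-lookup : ∀ (c : Pattern m) z → fits c z ≡ true → ∀ u → admits (lookup c u) (lookup z u) ≡ true
fits-lookup (t ∷ c) (b ∷ z) cz zero    = ∧-conicalˡ _ _ cz
fits-lookup (t ∷ c) (b ∷ z) cz (suc u) = fits-lookup c z (∧-conicalʳ _ _ cz) u

fits-everything : ∀ (z : Subset m) → fits everything z ≡ true
fits-everything []      = refl
fits-everything (_ ∷ z) = fits-everything z

sumMark-cong : ∀ t {g g′ : Bool → ℕ} → (∀ b → admits t b ≡ true → g b ≡ g′ b) → sumMark t g ≡ sumMark t g′
sumMark-cong incl e = e true refl
sumMark-cong excl e = e false refl
sumMark-cong free e = cong₂ _+_ (e false refl) (e true refl)

sumMark-mono : ∀ t {g g′ : Bool → ℕ} → (∀ b → admits t b ≡ true → g b ≤ g′ b) → sumMark t g ≤ sumMark t g′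
sumMark-mono incl e = e true refl
sumMark-mono excl e = e false refl
sumMark-mono free e = +-mono-≤ (e false refl) (e true refl)

sumMark-+ : ∀ t (g g′ : Bool → ℕ) → sumMark t (λ b → g b + g′ b) ≡ sumMark t g + sumMark t g′
sumMark-+ incl g g′ = refl
sumMark-+ excl g g′ = refl
sumMark-+ free g g′ = interchange (g false) (g′ false) (g true) (g′ true)

sumMark-* : ∀ t k (g : Bool → ℕ) → sumMark t (λ b → k * g b) ≡ k * sumMark t g
sumMark-* incl k g = refl
sumMark-* excl k g = refl
sumMark-* free k g = sym (*-distribˡ-+ k (g false) (g true))

sumMark-admitted : ∀ t {b} (g : Bool → ℕ) → admits t b ≡ true → g b ≤ sumMark t g
sumMark-admitted incl {true}  g _ = ≤-refl
sumMark-admitted excl {false} g _ = ≤-refl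
sumMark-admitted free {false} g _ = m≤m+n (g false) (g true)
sumMark-admitted free {true}  g _ = m≤n+m (g true) (g false)

sumFitting-cong : ∀ (c : Pattern m) {h h′ : Subset m → ℕ} →
  (∀ z → fits c z ≡ true → h z ≡ h′ z) → sumFitting c h ≡ sumFitting c h′
sumFitting-cong []      e = e [] refl
sumFitting-cong (t ∷ c) e = sumMark-cong t λ b tb → sumFitting-cong c λ z cz → e (b ∷ z) (fits-∷ t b c z tb cz)

sumFitting-mono : ∀ (c : Pattern m) {h h′ : Subset m → ℕ} →
  (∀ z → fits c z ≡ true → h z ≤ h′ z) → sumFitting c h ≤ sumFitting c h′
sumFitting-mono []      e = e [] refl
sumFitting-mono (t ∷ c) e = sumMark-mono t λ b tb → sumFitting-mono c λ z cz → e (b ∷ z) (fits-∷ t b c z tb cz)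

sumFitting-+ : ∀ (c : Pattern m) (h h′ : Subset m → ℕ) →
  sumFitting c (λ z → h z + h′ z) ≡ sumFitting c h + sumFitting c h′
sumFitting-+ []      h h′ = refl
sumFitting-+ (t ∷ c) h h′ = trans (sumMark-cong t λ b _ → sumFitting-+ c _ _) (sumMark-+ t _ _)

sumFitting-* : ∀ (c : Pattern m) k (h : Subset m → ℕ) → sumFitting c (λ z → k * h z) ≡ k * sumFitting c h
sumFitting-* []      k h = refl
sumFitting-* (t ∷ c) k h = trans (sumMark-cong t λ b _ → sumFitting-* c k _) (sumMark-* t k _)

sumFitting-zero : ∀ (c : Pattern m) → sumFitting c (λ _ → 0) ≡ 0
sumFitting-zero c = sumFitting-* c 0 (λ _ → 0)

sumFitting-point : ∀ (c : Pattern m) z (h : Subset m → ℕ) → fits c z ≡ true → h z ≤ sumFitting c h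
sumFitting-point []      []      h _  = ≤-refl
sumFitting-point (t ∷ c) (b ∷ z) h cz =
  ≤-trans (sumFitting-point c z (λ z′ → h (b ∷ z′)) (∧-conicalʳ _ _ cz))
          (sumMark-admitted t (λ b′ → sumFitting c (λ z′ → h (b′ ∷ z′))) (∧-conicalˡ _ _ cz))

sumFitting-∑ : ∀ {n} (c : Pattern m) (h : Fin n → Subset m → ℕ) →
  sumFitting c (λ z → ∑[ u < n ] h u z) ≡ ∑[ u < n ] sumFitting c (h u)
sumFitting-∑ {n = zero}  c h = sumFitting-zero c
sumFitting-∑ {n = suc n} c h =
  trans (sumFitting-+ c (h zero) _) (cong (sumFitting c (h zero) +_) (sumFitting-∑ c (λ u → h (suc u))))

𝟙-≢true : ∀ {b} → b ≢ true → 𝟙 b ≡ 0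
𝟙-≢true {false} _  = refl
𝟙-≢true {true}  b≢ = absurd (b≢ refl)

𝟙-mono : ∀ {a b} → (a ≡ true → b ≡ true) → 𝟙 a ≤ 𝟙 b
𝟙-mono {false} _ = z≤n
𝟙-mono {true}  a⇒b = ≤-reflexive (cong 𝟙 (sym (a⇒b refl)))

𝟙-∨ : ∀ a b → (a ≡ true → b ≡ true → Empty) → 𝟙 a + 𝟙 b ≡ 𝟙 (a ∨ b)
𝟙-∨ true  true  disj = absurd (disj refl refl)
𝟙-∨ true  false _    = refl
𝟙-∨ false _     _    = refl

𝟙≤1 : ∀ b → 𝟙 b ≤ 1
𝟙≤1 false = z≤n
𝟙≤1 true  = ≤-refl

𝟙-injective : ∀ {a b} → 𝟙 a ≡ 𝟙 b → a ≡ b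
𝟙-injective {false} {false} _ = refl
𝟙-injective {true}  {true}  _ = refl

count-none : ∀ (c : Pattern m) (F : Subset m → Bool) → (∀ z → fits c z ≡ true → F z ≢ true) → count F c ≡ 0
count-none c F none = trans (sumFitting-cong c λ z cz → 𝟙-≢true (none z cz)) (sumFitting-zero c)

count-point : ∀ (c : Pattern m) (F : Subset m → Bool) z → fits c z ≡ true → F z ≡ true → 1 ≤ count F c
count-point c F z cz Fz = subst (_≤ count F c) (cong 𝟙 Fz) (sumFitting-point c z _ cz)

count-mono : ∀ (c : Pattern m) (F G : Subset m → Bool) → (∀ z → fits c z ≡ true → F z ≡ true → G z ≡ true) →
  count F c ≤ count G c
count-mono c F G F⇒G = sumFitting-mono c λ z cz → 𝟙-mono (F⇒G z cz)

count-∨ : ∀ (c : Pattern m) (F G : Subset m → Bool) → (∀ z → F z ≡ true → G z ≡ true → Empty) →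
  count F c + count G c ≡ count (λ z → F z ∨ G z) c
count-∨ c F G disj = trans (sym (sumFitting-+ c _ _)) (sumFitting-cong c λ z _ → 𝟙-∨ (F z) (G z) (disj z))

count-∧false : ∀ (c : Pattern m) (G : Subset m → Bool) → count (λ z → G z ∧ false) c ≡ 0
count-∧false c G = count-none c (λ z → G z ∧ false) λ z _ e → false≢true (trans (sym (∧-zeroʳ (G z))) e)
  where
  false≢true : false ≢ true
  false≢true ()

count-restrict : ∀ (c : Pattern m) (F : Subset m → Bool) → count F c ≡ count (λ z → F z ∧ fits c z) everything
count-restrict []         F = cong 𝟙 (sym (∧-identityʳ (F [])))
count-restrict {suc n} (incl ∷ c) F =
  trans (count-restrict c _) (cong (_+ count (λ z → F (true ∷ z) ∧ fits c z) everything)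
                                   (sym (count-∧false (everything {n}) (λ z → F (false ∷ z)))))
count-restrict {suc n} (excl ∷ c) F =
  trans (count-restrict c _) (sym (trans (cong (count (λ z → F (false ∷ z) ∧ fits c z) everything +_)
                                               (count-∧false (everything {n}) (λ z → F (true ∷ z))))
                                         (+-identityʳ _)))
count-restrict (free ∷ c) F = cong₂ _+_ (count-restrict c _) (count-restrict c _)

count-+-≤ : ∀ (F : Subset m → Bool) (c₁ c₂ e : Pattern m) →
  (∀ z → F z ≡ true → fits c₁ z ≡ true → fits c₂ z ≡ true → Empty) →
  (∀ z → F z ≡ true → fits c₁ z ≡ true → fits e z ≡ true) →
  (∀ z → F z ≡ true → fits c₂ z ≡ true → fits e z ≡ true) →
  count F c₁ + count F c₂ ≤ count F e
count-+-≤ {m} F c₁ c₂ e disj in₁ in₂ = begin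
  count F c₁ + count F c₂                   ≡⟨ cong₂ _+_ (count-restrict c₁ F) (count-restrict c₂ F) ⟩
  count F₁ everything + count F₂ everything ≡⟨ count-∨ everything F₁ F₂ disj′ ⟩
  count (λ z → F₁ z ∨ F₂ z) everything      ≤⟨ count-mono everything _ _ into ⟩
  count (λ z → F z ∧ fits e z) everything   ≡⟨ count-restrict e F ⟨
  count F e                                 ∎
  where
  open ≤-Reasoning
  F₁ F₂ : Subset m → Bool
  F₁ z = F z ∧ fits c₁ z
  F₂ z = F z ∧ fits c₂ z
  disj′ : ∀ z → F₁ z ≡ true → F₂ z ≡ true → Empty
  disj′ z p q = disj z (∧-conicalˡ _ _ p) (∧-conicalʳ _ _ p) (∧-conicalʳ _ _ q)
  into : ∀ z → fits everything z ≡ true → F₁ z ∨ F₂ z ≡ true → F z ∧ fits e z ≡ true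
  into z _ p with ∨-true (F₁ z) (F₂ z) p
  ... | inj₁ q = cong₂ _∧_ (∧-conicalˡ _ _ q) (in₁ z (∧-conicalˡ _ _ q) (∧-conicalʳ _ _ q))
  ... | inj₂ q = cong₂ _∧_ (∧-conicalˡ _ _ q) (in₂ z (∧-conicalˡ _ _ q) (∧-conicalʳ _ _ q))

sumMark-≤-single : ∀ t b₀ {g : Bool → ℕ} {x} → (admits t b₀ ≡ true → g b₀ ≤ x) →
  (∀ b → admits t b ≡ true → b ≢ b₀ → g b ≡ 0) → sumMark t g ≤ x
sumMark-≤-single incl true  at _    = at refl
sumMark-≤-single incl false _  rest = ≤-trans (≤-reflexive (rest true refl λ ())) z≤n
sumMark-≤-single excl false at _    = at refl
sumMark-≤-single excl true  _  rest = ≤-trans (≤-reflexive (rest false refl λ ())) z≤n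
sumMark-≤-single free false {g} at rest =
  ≤-trans (≤-reflexive (trans (cong (g false +_) (rest true refl λ ())) (+-identityʳ _))) (at refl)
sumMark-≤-single free true  {g} at rest = ≤-trans (≤-reflexive (cong (_+ g true) (rest false refl λ ()))) (at refl)

count-≤-𝟙 : ∀ (c : Pattern m) (F : Subset m → Bool) z₀ →
  (∀ z → fits c z ≡ true → F z ≡ true → z ≡ z₀) → count F c ≤ 𝟙 (F z₀)
count-≤-𝟙 []      F []        _    = ≤-refl
count-≤-𝟙 (t ∷ c) F (b₀ ∷ z₀) only = sumMark-≤-single t b₀
  (λ tb → count-≤-𝟙 c (λ z → F (b₀ ∷ z)) z₀ λ z cz Fz → ∷-injectiveʳ (only (b₀ ∷ z) (fits-∷ t b₀ c z tb cz) Fz))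
  (λ b tb b≢b₀ → count-none c (λ z → F (b ∷ z)) λ z cz Fz → b≢b₀ (∷-injectiveˡ (only (b ∷ z) (fits-∷ t b c z tb cz) Fz)))

count-weighted : ∀ (c : Pattern m) (F : Subset m → Bool) (h : Subset m → ℕ) w →
  (∀ z → fits c z ≡ true → F z ≡ true → h z ≡ w) → sumFitting c (λ z → 𝟙 (F z) * h z) ≡ w * count F c
count-weighted c F h w hw = trans (sumFitting-cong c weight) (sumFitting-* c w _)
  where
  weight : ∀ z → fits c z ≡ true → 𝟙 (F z) * h z ≡ w * 𝟙 (F z)
  weight z cz with F z in Fz
  ... | false = sym (*-zeroʳ w)
  ... | true  = trans (+-identityʳ _) (trans (hw z cz Fz) (sym (*-identityʳ w)))

_≟ᴹ_ : DecidableEquality Mark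
incl ≟ᴹ incl = yes refl
excl ≟ᴹ excl = yes refl
free ≟ᴹ free = yes refl
incl ≟ᴹ excl = no λ ()
incl ≟ᴹ free = no λ ()
excl ≟ᴹ incl = no λ ()
excl ≟ᴹ free = no λ ()
free ≟ᴹ incl = no λ ()
free ≟ᴹ excl = no λ ()

is : Mark → Mark → ℕ
is x t = 𝟙 (does (t ≟ᴹ x))

is-self : ∀ x → is x x ≡ 1
is-self incl = refl
is-self excl = refl
is-self free = refl

tally : (Mark → ℕ) → Pattern m → ℕ
tally f []      = 0
tally f (t ∷ c) = f t + tally f c

#[_] : Mark → Pattern m → ℕ
#[ x ] = tally (is x)

tally-[]≔ : ∀ (f : Mark → ℕ) (c : Pattern m) u x → tally f (c [ u ]≔ x) + f (lookup c u) ≡ tally f c + f x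
tally-[]≔ f (t ∷ c) zero    x = trans (+-assoc (f x) _ _) (trans (cong (f x +_) (+-comm _ (f t))) (+-comm (f x) _))
tally-[]≔ f (t ∷ c) (suc u) x =
  trans (+-assoc (f t) _ _) (trans (cong (f t +_) (tally-[]≔ f c u x)) (sym (+-assoc (f t) _ _)))

tally-map : ∀ (f f′ : Mark → ℕ) g (c : Pattern m) → (∀ t → f (g t) ≡ f′ t) → tally f (map g c) ≡ tally f′ c
tally-map f f′ g []      _ = refl
tally-map f f′ g (t ∷ c) e = cong₂ _+_ (e t) (tally-map f f′ g c e)

∑-lookup : ∀ (f : Mark → ℕ) (c : Pattern m) → ∑[ u < m ] f (lookup c u) ≡ tally f c
∑-lookup f []      = refl
∑-lookup f (t ∷ c) = cong (f t +_) (∑-lookup f c)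

tally-marks : ∀ (c : Pattern m) → #[ incl ] c + #[ excl ] c + #[ free ] c ≡ m
tally-marks []         = refl
tally-marks (incl ∷ c) = cong suc (tally-marks c)
tally-marks (excl ∷ c) = trans (cong (_+ #[ free ] c) (+-suc (#[ incl ] c) _)) (cong suc (tally-marks c))
tally-marks (free ∷ c) = trans (+-suc (#[ incl ] c + #[ excl ] c) _) (cong suc (tally-marks c))

#-suc⇒∃ : ∀ x (c : Pattern m) {o} → #[ x ] c ≡ suc o → ∃ λ u → lookup c u ≡ x
#-suc⇒∃ x (t ∷ c) e with t ≟ᴹ x
... | yes t≡x = zero , t≡x
... | no _    = let u , cu = #-suc⇒∃ x c e in suc u , cu

#-[]≔ : ∀ x (c : Pattern m) u {t t′} → lookup c u ≡ t → #[ x ] (c [ u ]≔ t′) + is x t ≡ #[ x ] c + is x t′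
#-[]≔ x c u refl = tally-[]≔ (is x) c u _

#-[]≔-same : ∀ x (c : Pattern m) u {t t′} → lookup c u ≡ t → is x t ≡ 0 → is x t′ ≡ 0 →
  #[ x ] (c [ u ]≔ t′) ≡ #[ x ] c
#-[]≔-same x c u {t} {t′} cu t≢x t′≢x = begin
  #[ x ] (c [ u ]≔ t′)         ≡⟨ +-identityʳ _ ⟨
  #[ x ] (c [ u ]≔ t′) + 0     ≡⟨ cong (#[ x ] (c [ u ]≔ t′) +_) t≢x ⟨
  #[ x ] (c [ u ]≔ t′) + is x t ≡⟨ #-[]≔ x c u cu ⟩
  #[ x ] c + is x t′           ≡⟨ cong (#[ x ] c +_) t′≢x ⟩
  #[ x ] c + 0                 ≡⟨ +-identityʳ _ ⟩
  #[ x ] c                     ∎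
  where open ≡-Reasoning

#-[]≔-gain : ∀ x (c : Pattern m) u {t} → lookup c u ≡ t → is x t ≡ 0 → #[ x ] (c [ u ]≔ x) ≡ suc (#[ x ] c)
#-[]≔-gain x c u {t} cu t≢x = begin
  #[ x ] (c [ u ]≔ x)          ≡⟨ +-identityʳ _ ⟨
  #[ x ] (c [ u ]≔ x) + 0      ≡⟨ cong (#[ x ] (c [ u ]≔ x) +_) t≢x ⟨
  #[ x ] (c [ u ]≔ x) + is x t ≡⟨ #-[]≔ x c u cu ⟩
  #[ x ] c + is x x            ≡⟨ cong (#[ x ] c +_) (is-self x) ⟩
  #[ x ] c + 1                 ≡⟨ +-comm _ 1 ⟩
  suc (#[ x ] c)               ∎
  where open ≡-Reasoning

#-[]≔-lose : ∀ x (c : Pattern m) u {t′} → lookup c u ≡ x → is x t′ ≡ 0 → suc (#[ x ] (c [ u ]≔ t′)) ≡ #[ x ] c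
#-[]≔-lose x c u {t′} cu t′≢x = begin
  suc (#[ x ] (c [ u ]≔ t′))     ≡⟨ +-comm 1 _ ⟩
  #[ x ] (c [ u ]≔ t′) + 1       ≡⟨ cong (#[ x ] (c [ u ]≔ t′) +_) (is-self x) ⟨
  #[ x ] (c [ u ]≔ t′) + is x x  ≡⟨ #-[]≔ x c u cu ⟩
  #[ x ] c + is x t′             ≡⟨ cong (#[ x ] c +_) t′≢x ⟩
  #[ x ] c + 0                   ≡⟨ +-identityʳ _ ⟩
  #[ x ] c                       ∎
  where open ≡-Reasoning

#excl-after : ∀ (c : Pattern m) u x {o} → lookup c u ≡ excl → #[ excl ] c ≡ suc o → is excl x ≡ 0 →
  #[ excl ] (c [ u ]≔ x) ≡ o
#excl-after c u x cu ec x≢excl = suc-injective (trans (#-[]≔-lose excl c u cu x≢excl) ec)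

#-everything : ∀ x → is x free ≡ 0 → #[ x ] (everything {m}) ≡ 0
#-everything {zero}  x _   = refl
#-everything {suc m} x x≢f = trans (cong (_+ #[ x ] (everything {m})) x≢f) (#-everything {m} x x≢f)

lookup-[]≔incl-free : ∀ (c : Pattern m) u v → lookup (c [ u ]≔ incl) v ≡ free → lookup c v ≡ free
lookup-[]≔incl-free c u v cv with u Fin.≟ v
... | yes refl = case trans (sym (lookup∘update u c incl)) cv of λ ()
... | no u≢v   = trans (sym (lookup∘update′ (u≢v ∘ sym) c incl)) cv

sumFitting-split : ∀ (c : Pattern m) u (h : Subset m → ℕ) → lookup c u ≡ free →
  sumFitting c h ≡ sumFitting (c [ u ]≔ incl) h + sumFitting (c [ u ]≔ excl) h
sumFitting-split (free ∷ c) zero    h refl = +-comm (sumFitting c (λ z → h (false ∷ z))) _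
sumFitting-split (t ∷ c)    (suc u) h cu   =
  trans (sumMark-cong t λ b _ → sumFitting-split c u _ cu) (sumMark-+ t _ _)

count-split-excl : ∀ (F : Subset m → Bool) (c : Pattern m) u → lookup c u ≡ excl →
  count F (c [ u ]≔ free) ≡ count F (c [ u ]≔ incl) + count F c
count-split-excl F c u cu = trans (sumFitting-split (c [ u ]≔ free) u _ (lookup∘update u c free))
  (cong₂ (λ p q → count F p + count F q) ([]≔-idempotent c u)
                                          (trans ([]≔-idempotent c u) (trans (cong (c [ u ]≔_) (sym cu)) ([]≔-lookup c u))))

sumMark-weighted : ∀ x (g : Bool → ℕ) → sumMark x g ≡ sumMark free (λ b → 𝟙 (admits x b) * g b)
sumMark-weighted incl g = sym (+-identityʳ (g true))
sumMark-weighted excl g = sym (trans (+-identityʳ _) (+-identityʳ (g false)))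
sumMark-weighted free g = sym (cong₂ _+_ (+-identityʳ (g false)) (+-identityʳ (g true)))

sumFitting-fix : ∀ (c : Pattern m) u x (h : Subset m → ℕ) → lookup c u ≡ free →
  sumFitting (c [ u ]≔ x) h ≡ sumFitting c (λ z → 𝟙 (admits x (lookup z u)) * h z)
sumFitting-fix (free ∷ c) zero    x h refl =
  trans (sumMark-weighted x _) (sumMark-cong free λ b _ → sym (sumFitting-* c (𝟙 (admits x b)) (λ z → h (b ∷ z))))
sumFitting-fix (t ∷ c)    (suc u) x h cu   = sumMark-cong t λ b _ → sumFitting-fix c u x (λ z → h (b ∷ z)) cu

freeAgreeing : Mark → Pattern m → Subset m → ℕ
freeAgreeing {m} x c z = ∑[ u < m ] (is free (lookup c u) * 𝟙 (admits x (lookup z u)))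

-- Each subset fitting c is counted once for every free position of c at which it admits x.
double-counting : ∀ (c : Pattern m) x (h : Subset m → ℕ) →
  ∑[ u < m ] (is free (lookup c u) * sumFitting (c [ u ]≔ x) h) ≡ sumFitting c (λ z → h z * freeAgreeing x c z)
double-counting {m} c x h = begin
  ∑[ u < m ] (is free (lookup c u) * sumFitting (c [ u ]≔ x) h) ≡⟨ sum-cong-≗ at ⟩
  ∑[ u < m ] sumFitting c (λ z → h z * w u z)                   ≡⟨ sumFitting-∑ c (λ u z → h z * w u z) ⟨
  sumFitting c (λ z → ∑[ u < m ] (h z * w u z))                 ≡⟨ sumFitting-cong c (λ z _ → *-distribˡ-sum (h z) (λ u → w u z)) ⟨
  sumFitting c (λ z → h z * freeAgreeing x c z)                 ∎
  where
  open ≡-Reasoning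
  w : Fin m → Subset m → ℕ
  w u z = is free (lookup c u) * 𝟙 (admits x (lookup z u))
  at : ∀ u → is free (lookup c u) * sumFitting (c [ u ]≔ x) h ≡ sumFitting c (λ z → h z * w u z)
  at u with lookup c u in cu
  ... | free = trans (+-identityʳ _) (trans (sumFitting-fix c u x h cu)
                 (sumFitting-cong c λ z _ → trans (*-comm _ (h z)) (cong (h z *_) (sym (+-identityʳ _)))))
  ... | incl = sym (trans (sumFitting-cong c λ z _ → *-zeroʳ (h z)) (sumFitting-zero c))
  ... | excl = sym (trans (sumFitting-cong c λ z _ → *-zeroʳ (h z)) (sumFitting-zero c))

freeAgreeing-incl : ∀ (c : Pattern m) z → fits c z ≡ true → freeAgreeing incl c z + #[ incl ] c ≡ ∣ z ∣
freeAgreeing-incl []         []            _  = refl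
freeAgreeing-incl (incl ∷ c) (inside ∷ z)  cz = trans (+-suc _ _) (cong suc (freeAgreeing-incl c z cz))
freeAgreeing-incl (excl ∷ c) (outside ∷ z) cz = freeAgreeing-incl c z cz
freeAgreeing-incl (free ∷ c) (inside ∷ z)  cz = cong suc (freeAgreeing-incl c z cz)
freeAgreeing-incl (free ∷ c) (outside ∷ z) cz = freeAgreeing-incl c z cz

freeAgreeing-excl : ∀ (c : Pattern m) z → fits c z ≡ true → freeAgreeing excl c z + #[ excl ] c + ∣ z ∣ ≡ m
freeAgreeing-excl []         []            _  = refl
freeAgreeing-excl (incl ∷ c) (inside ∷ z)  cz = trans (+-suc _ _) (cong suc (freeAgreeing-excl c z cz))
freeAgreeing-excl (excl ∷ c) (outside ∷ z) cz =
  trans (cong (_+ ∣ z ∣) (+-suc _ _)) (cong suc (freeAgreeing-excl c z cz))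
freeAgreeing-excl (free ∷ c) (inside ∷ z)  cz = trans (+-suc _ _) (cong suc (freeAgreeing-excl c z cz))
freeAgreeing-excl (free ∷ c) (outside ∷ z) cz = cong suc (freeAgreeing-excl c z cz)

freeAgreeing-incl-zero : ∀ (c : Pattern m) z → freeAgreeing incl c z ≡ 0 →
  ∀ u → lookup c u ≡ free → lookup z u ≡ false
freeAgreeing-incl-zero (free ∷ c) (outside ∷ z) _ zero    _  = refl
freeAgreeing-incl-zero (t ∷ c)    (b ∷ z)       e (suc u) cu =
  freeAgreeing-incl-zero c z (m+n≡0⇒n≡0 (is free t * 𝟙 b) e) u cu

tight-fit-avoids-free : ∀ (c : Pattern m) z → fits c z ≡ true → ∣ z ∣ ≡ #[ incl ] c →
  ∀ u → lookup c u ≡ free → lookup z u ≡ false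
tight-fit-avoids-free c z cz ∣z∣ = freeAgreeing-incl-zero c z
  (+-cancelʳ-≡ (#[ incl ] c) _ 0 (trans (freeAgreeing-incl c z cz) ∣z∣))

containing : Subset m → Pattern m
containing = map λ b → if b then incl else free

disjointFrom : Subset m → Pattern m
disjointFrom = map λ b → if b then excl else free

fits-containing-self : ∀ (y : Subset m) → fits (containing y) y ≡ true
fits-containing-self []            = refl
fits-containing-self (inside ∷ y)  = fits-containing-self y
fits-containing-self (outside ∷ y) = fits-containing-self y

fits-containing⇒⊆ : ∀ (y z : Subset m) → fits (containing y) z ≡ true → y ⊆ z
fits-containing⇒⊆ []            []            _  = λ ()
fits-containing⇒⊆ (outside ∷ y) (b ∷ z)       yz = out⊆ (fits-containing⇒⊆ y z yz)
fits-containing⇒⊆ (inside ∷ y)  (inside ∷ z)  yz = s⊆s (fits-containing⇒⊆ y z yz)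

fits-disjointFrom⇒ : ∀ (y z : Subset m) → fits (disjointFrom y) z ≡ true → z ∩ y ≡ ⊥
fits-disjointFrom⇒ []            []             _  = refl
fits-disjointFrom⇒ (outside ∷ y) (b ∷ z)        yz = cong₂ _∷_ (∧-zeroʳ b) (fits-disjointFrom⇒ y z yz)
fits-disjointFrom⇒ (inside ∷ y)  (outside ∷ z)  yz = cong (outside ∷_) (fits-disjointFrom⇒ y z yz)

fits-disjointFrom⇐ : ∀ (y z : Subset m) → z ∩ y ≡ ⊥ → fits (disjointFrom y) z ≡ true
fits-disjointFrom⇐ []            []            _  = refl
fits-disjointFrom⇐ (outside ∷ y) (b ∷ z)       zy = fits-disjointFrom⇐ y z (∷-injectiveʳ zy)
fits-disjointFrom⇐ (inside ∷ y)  (outside ∷ z) zy = fits-disjointFrom⇐ y z (∷-injectiveʳ zy)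
fits-disjointFrom⇐ (inside ∷ y)  (inside ∷ z)  zy with ∷-injectiveˡ zy
... | ()

#incl-containing : ∀ (y : Subset m) → #[ incl ] (containing y) ≡ ∣ y ∣
#incl-containing []            = refl
#incl-containing (inside ∷ y)  = cong suc (#incl-containing y)
#incl-containing (outside ∷ y) = #incl-containing y

#excl-containing : ∀ (y : Subset m) → #[ excl ] (containing y) ≡ 0
#excl-containing []            = refl
#excl-containing (inside ∷ y)  = #excl-containing y
#excl-containing (outside ∷ y) = #excl-containing y

isIncl : Mark → Bool
isIncl t = does (t ≟ᴹ incl)

inclSet : Pattern m → Subset m
inclSet = map isIncl

∣inclSet∣ : ∀ (c : Pattern m) → ∣ inclSet c ∣ ≡ #[ incl ] c
∣inclSet∣ []         = refl
∣inclSet∣ (incl ∷ c) = cong suc (∣inclSet∣ c)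
∣inclSet∣ (excl ∷ c) = ∣inclSet∣ c
∣inclSet∣ (free ∷ c) = ∣inclSet∣ c

fits⇒inclSet⊆ : ∀ (c : Pattern m) z → fits c z ≡ true → inclSet c ⊆ z
fits⇒inclSet⊆ []         []           _  = λ ()
fits⇒inclSet⊆ (incl ∷ c) (inside ∷ z) cz = s⊆s (fits⇒inclSet⊆ c z cz)
fits⇒inclSet⊆ (excl ∷ c) (b ∷ z)      cz = out⊆ (fits⇒inclSet⊆ c z (∧-conicalʳ _ _ cz))
fits⇒inclSet⊆ (free ∷ c) (b ∷ z)      cz = out⊆ (fits⇒inclSet⊆ c z cz)

containing-inclSet : ∀ (c : Pattern m) → #[ excl ] c ≡ 0 → containing (inclSet c) ≡ c
containing-inclSet []         _ = refl
containing-inclSet (incl ∷ c) e = cong (incl ∷_) (containing-inclSet c e)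
containing-inclSet (free ∷ c) e = cong (free ∷_) (containing-inclSet c e)

avoid : Mark → Mark
avoid incl = excl
avoid excl = excl
avoid free = free

avoiding : Pattern m → Pattern m
avoiding = map avoid

avoiding-containing : ∀ (y : Subset m) → avoiding (containing y) ≡ disjointFrom y
avoiding-containing []            = refl
avoiding-containing (inside ∷ y)  = cong (excl ∷_) (avoiding-containing y)
avoiding-containing (outside ∷ y) = cong (free ∷_) (avoiding-containing y)

#excl-avoiding : ∀ (c : Pattern m) → #[ excl ] (avoiding c) ≡ #[ incl ] c + #[ excl ] c
#excl-avoiding []         = refl
#excl-avoiding (incl ∷ c) = cong suc (#excl-avoiding c)
#excl-avoiding (excl ∷ c) = trans (cong suc (#excl-avoiding c)) (sym (+-suc _ _))
#excl-avoiding (free ∷ c) = #excl-avoiding c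

#incl-avoiding : ∀ (c : Pattern m) → #[ incl ] (avoiding c) ≡ 0
#incl-avoiding []         = refl
#incl-avoiding (incl ∷ c) = #incl-avoiding c
#incl-avoiding (excl ∷ c) = #incl-avoiding c
#incl-avoiding (free ∷ c) = #incl-avoiding c

swapInclFree : Mark → Mark
swapInclFree incl = free
swapInclFree excl = excl
swapInclFree free = incl

fits-avoiding-swapInclFree : ∀ (c : Pattern m) z → #[ excl ] c ≡ 0 → (∀ u → lookup c u ≡ free → lookup z u ≡ false) →
  fits (avoiding (map swapInclFree c)) z ≡ true
fits-avoiding-swapInclFree []         []      _ _     = refl
fits-avoiding-swapInclFree (incl ∷ c) (b ∷ z) e tight = fits-avoiding-swapInclFree c z e λ u → tight (suc u)
fits-avoiding-swapInclFree (free ∷ c) (b ∷ z) e tight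
  rewrite tight zero refl = fits-avoiding-swapInclFree c z e λ u → tight (suc u)

exclToIncl : Mark → Mark
exclToIncl excl = incl
exclToIncl t    = t

exclToIncl-[]≔ : ∀ (c : Pattern m) u → lookup c u ≡ excl → map exclToIncl (c [ u ]≔ incl) ≡ map exclToIncl c
exclToIncl-[]≔ c u cu = trans (map-[]≔ exclToIncl c u)
  (trans (cong (map exclToIncl c [ u ]≔_) (sym (trans (lookup-map u exclToIncl c) (cong exclToIncl cu))))
         ([]≔-lookup (map exclToIncl c) u))

exclToIncl-id : ∀ (c : Pattern m) → #[ excl ] c ≡ 0 → map exclToIncl c ≡ c
exclToIncl-id []         _ = refl
exclToIncl-id (incl ∷ c) e = cong (incl ∷_) (exclToIncl-id c e)
exclToIncl-id (free ∷ c) e = cong (free ∷_) (exclToIncl-id c e)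

exclToIncl-avoiding : ∀ (c : Pattern m) → #[ excl ] c ≡ 0 → map exclToIncl (avoiding c) ≡ c
exclToIncl-avoiding []         _ = refl
exclToIncl-avoiding (incl ∷ c) e = cong (incl ∷_) (exclToIncl-avoiding c e)
exclToIncl-avoiding (free ∷ c) e = cong (free ∷_) (exclToIncl-avoiding c e)

-- Families of k-sets satisfying the perfect code equations

-- Here k = j + 1, and A, C below play the two layers of a perfect code of O_{k+1} × K₂.
module KSetFamilies (j m : ℕ) (m≡ : m ≡ 3 + (j + j)) where

  KSets : (Subset m → Bool) → Set
  KSets F = ∀ z → F z ≡ true → ∣ z ∣ ≡ suc j

  CodeEquation : (Subset m → Bool) → (Subset m → Bool) → Set
  CodeEquation F F′ = ∀ y → ∣ y ∣ ≡ suc j → 𝟙 (F y) + count F′ (disjointFrom y) ≡ 1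

  extensions : Mark → (Subset m → Bool) → Pattern m → ℕ
  extensions x F c = ∑[ u < m ] (is free (lookup c u) * count F (c [ u ]≔ x))

  module _ {F : Subset m → Bool} (kF : KSets F) where

    count-≤1 : ∀ (c : Pattern m) → #[ incl ] c ≡ suc j → count F c ≤ 1
    count-≤1 c ic = ≤-trans (count-≤-𝟙 c F (inclSet c) only) (𝟙≤1 (F (inclSet c)))
      where
      only : ∀ z → fits c z ≡ true → F z ≡ true → z ≡ inclSet c
      only z cz Fz = sym (⊆-∣∣≤⇒≡ (fits⇒inclSet⊆ c z cz) (≤-reflexive (trans (kF z Fz) (sym (trans (∣inclSet∣ c) ic)))))

    count-containing : ∀ y → ∣ y ∣ ≡ suc j → count F (containing y) ≡ 𝟙 (F y)
    count-containing y ∣y∣ = ≤-antisym (count-≤-𝟙 (containing y) F y only)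
                                       (sumFitting-point (containing y) y _ (fits-containing-self y))
      where
      only : ∀ z → fits (containing y) z ≡ true → F z ≡ true → z ≡ y
      only z yz Fz = sym (⊆-∣∣≤⇒≡ (fits-containing⇒⊆ y z yz) (≤-reflexive (trans (kF z Fz) (sym ∣y∣))))

    pattern-code-equation : ∀ {F′} → CodeEquation F F′ → ∀ c → #[ excl ] c ≡ 0 → #[ incl ] c ≡ suc j →
      count F c + count F′ (avoiding c) ≡ 1
    pattern-code-equation {F′} eq c ec ic = begin
      count F c + count F′ (avoiding c)                           ≡⟨ cong (λ d → count F d + count F′ (avoiding d)) c≡ ⟨
      count F (containing y) + count F′ (avoiding (containing y)) ≡⟨ cong₂ _+_ (count-containing y ∣y∣)
                                                                              (cong (count F′) (avoiding-containing y)) ⟩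
      𝟙 (F y) + count F′ (disjointFrom y)                         ≡⟨ eq y ∣y∣ ⟩
      1                                                           ∎
      where
      open ≡-Reasoning
      y : Subset m
      y = inclSet c
      ∣y∣ : ∣ y ∣ ≡ suc j
      ∣y∣ = trans (∣inclSet∣ c) ic
      c≡ : containing y ≡ c
      c≡ = containing-inclSet c ec

    extensions-incl : ∀ (c : Pattern m) {i} → #[ incl ] c ≡ i → extensions incl F c ≡ (suc j ∸ i) * count F c
    extensions-incl c ic = trans (double-counting c incl _) (count-weighted c F _ _ λ z cz Fz →
      +⇒∸ (trans (cong (freeAgreeing incl c z +_) (sym ic)) (trans (freeAgreeing-incl c z cz) (kF z Fz))))

    extensions-excl : ∀ (c : Pattern m) {o} → #[ excl ] c ≡ o → extensions excl F c ≡ (m ∸ suc j ∸ o) * count F c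
    extensions-excl c ec = trans (double-counting c excl _) (count-weighted c F _ _ λ z cz Fz →
      +⇒∸ (+⇒∸ (trans (cong₂ (λ o s → freeAgreeing excl c z + o + s) (sym ec) (sym (kF z Fz))) (freeAgreeing-excl c z cz))))

  #free-shadow : ∀ (c : Pattern m) → #[ excl ] c ≡ 0 → #[ incl ] c ≡ j → #[ free ] c ≡ 3 + j
  #free-shadow c ec ic = +-cancelʳ-≡ j _ (3 + j) (begin
    #[ free ] c + j                          ≡⟨ +-comm _ j ⟩
    j + #[ free ] c                          ≡⟨ cong (λ i → i + #[ free ] c) (+-identityʳ j) ⟨
    j + 0 + #[ free ] c                      ≡⟨ cong₂ (λ i e → i + e + #[ free ] c) ic ec ⟨
    #[ incl ] c + #[ excl ] c + #[ free ] c  ≡⟨ tally-marks c ⟩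
    m                                        ≡⟨ m≡ ⟩
    3 + j + j                                ∎)
    where open ≡-Reasoning

  module _ {A C : Subset m → Bool} (kA : KSets A) (kC : KSets C) (eqAC : CodeEquation A C) where

    -- Sum the code equation over the k + 2 one-point extensions of c: a member of A fitting c is
    -- counted once, a member of C avoiding c twice.
    shadow-equation : ∀ c → #[ excl ] c ≡ 0 → #[ incl ] c ≡ j → count A c + 2 * count C (avoiding c) ≡ 3 + j
    shadow-equation c ec ic = begin
      count A c + 2 * count C (avoiding c)
        ≡⟨ cong₂ _+_ (trans (cong (_* count A c) (m+n∸n≡m 1 j)) (*-identityˡ _)) (cong (_* count C (avoiding c)) two) ⟨
      (suc j ∸ j) * count A c + (m ∸ suc j ∸ j) * count C (avoiding c)
        ≡⟨ cong₂ _+_ (extensions-incl kA c ic) (extensions-excl kC (avoiding c) ec′) ⟨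
      extensions incl A c + extensions excl C (avoiding c)
        ≡⟨ ∑-distrib-+ (λ u → is free (lookup c u) * count A (c [ u ]≔ incl)) _ ⟨
      ∑[ u < m ] (is free (lookup c u) * count A (c [ u ]≔ incl)
                  + is free (lookup (avoiding c) u) * count C (avoiding c [ u ]≔ excl))
        ≡⟨ sum-cong-≗ at ⟩
      ∑[ u < m ] is free (lookup c u)
        ≡⟨ ∑-lookup (is free) c ⟩
      #[ free ] c
        ≡⟨ #free-shadow c ec ic ⟩
      3 + j ∎
      where
      open ≡-Reasoning
      two : m ∸ suc j ∸ j ≡ 2
      two = trans (cong (λ i → i ∸ suc j ∸ j) m≡) (trans (∸-+-assoc (3 + (j + j)) (suc j) j) (m+n∸n≡m 2 (j + j)))
      ec′ : #[ excl ] (avoiding c) ≡ j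
      ec′ = trans (#excl-avoiding c) (trans (cong₂ _+_ ic ec) (+-identityʳ j))
      at : ∀ u → is free (lookup c u) * count A (c [ u ]≔ incl)
                 + is free (lookup (avoiding c) u) * count C (avoiding c [ u ]≔ excl) ≡ is free (lookup c u)
      at u rewrite lookup-map u avoid c with lookup c u in cu
      ... | incl = refl
      ... | excl = refl
      ... | free = trans (cong₂ _+_ (*-identityˡ _) (trans (*-identityˡ _) (cong (count C) (sym (map-[]≔ avoid c u)))))
                     (pattern-code-equation kA eqAC (c [ u ]≔ incl) (trans (#-[]≔-same excl c u cu refl refl) ec)
                                                            (trans (#-[]≔-gain incl c u cu refl) (cong suc ic)))

  module _ {A C : Subset m → Bool} (kA : KSets A) (kC : KSets C) (eqCA : CodeEquation C A) where

    -- Members of A fitting either extension avoid the k-set of positions left free by both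
    -- (the incl-set of d), and the code equation at d allows at most one such member.
    two-extensions≤1 : ∀ c u₁ u₂ → #[ excl ] c ≡ 0 → #[ incl ] c ≡ j → u₁ ≢ u₂ →
      lookup c u₁ ≡ free → lookup c u₂ ≡ free → count A (c [ u₁ ]≔ incl) + count A (c [ u₂ ]≔ incl) ≤ 1
    two-extensions≤1 c u₁ u₂ ec ic u₁≢u₂ cu₁ cu₂ =
      ≤-trans (count-+-≤ A c₁ c₂ e disjoint into₁ into₂)
              (≤-trans (m≤n+m _ (count C d)) (≤-reflexive (pattern-code-equation kC eqCA d excl-d incl-d)))
      where
      c₁ c₂ c₁₂ d e : Pattern m
      c₁ = c [ u₁ ]≔ incl
      c₂ = c [ u₂ ]≔ incl
      c₁₂ = c₁ [ u₂ ]≔ incl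
      d = map swapInclFree c₁₂
      e = avoiding d
      c₁u₂ : lookup c₁ u₂ ≡ free
      c₁u₂ = trans (lookup∘update′ (u₁≢u₂ ∘ sym) c incl) cu₂
      c₁₂≡ : c₁₂ ≡ c₂ [ u₁ ]≔ incl
      c₁₂≡ = []≔-commutes c u₁ u₂ u₁≢u₂
      ec₁₂ : #[ excl ] c₁₂ ≡ 0
      ec₁₂ = trans (#-[]≔-same excl c₁ u₂ c₁u₂ refl refl) (trans (#-[]≔-same excl c u₁ cu₁ refl refl) ec)
      excl-d : #[ excl ] d ≡ 0
      excl-d = trans (tally-map (is excl) (is excl) swapInclFree c₁₂ λ { incl → refl ; excl → refl ; free → refl }) ec₁₂
      incl-d : #[ incl ] d ≡ suc j
      incl-d = trans (tally-map (is incl) (is free) swapInclFree c₁₂ λ { incl → refl ; excl → refl ; free → refl })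
             (suc-injective (suc-injective (trans (cong suc (#-[]≔-lose free c₁ u₂ c₁u₂ refl))
               (trans (#-[]≔-lose free c u₁ cu₁ refl) (#free-shadow c ec ic)))))
      tight : ∀ uᵢ → lookup c uᵢ ≡ free → ∀ z → A z ≡ true → fits (c [ uᵢ ]≔ incl) z ≡ true →
        ∀ v → lookup (c [ uᵢ ]≔ incl) v ≡ free → lookup z v ≡ false
      tight uᵢ cuᵢ z Az cz = tight-fit-avoids-free (c [ uᵢ ]≔ incl) z cz
        (trans (kA z Az) (sym (trans (#-[]≔-gain incl c uᵢ cuᵢ refl) (cong suc ic))))
      into₁ : ∀ z → A z ≡ true → fits c₁ z ≡ true → fits e z ≡ true
      into₁ z Az cz = fits-avoiding-swapInclFree c₁₂ z ec₁₂ λ v c₁₂v →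
        tight u₁ cu₁ z Az cz v (lookup-[]≔incl-free c₁ u₂ v c₁₂v)
      into₂ : ∀ z → A z ≡ true → fits c₂ z ≡ true → fits e z ≡ true
      into₂ z Az cz = fits-avoiding-swapInclFree c₁₂ z ec₁₂ λ v c₁₂v →
        tight u₂ cu₂ z Az cz v (lookup-[]≔incl-free c₂ u₁ v (subst (λ p → lookup p v ≡ free) c₁₂≡ c₁₂v))
      disjoint : ∀ z → A z ≡ true → fits c₁ z ≡ true → fits c₂ z ≡ true → Empty
      disjoint z Az cz₁ cz₂ with trans (sym (tight u₁ cu₁ z Az cz₁ u₂ c₁u₂))
                                 (subst (λ t → admits t (lookup z u₂) ≡ true) (lookup∘update u₂ c incl) (fits-lookup c₂ z cz₂ u₂))
      ... | ()

    shadow≤1 : ∀ c → #[ excl ] c ≡ 0 → #[ incl ] c ≡ j → count A c ≤ 1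
    shadow≤1 c ec ic = subst (_≤ 1) ∑term≡ (∑-≤1 term term≤1 no-two)
      where
      term : Fin m → ℕ
      term u = is free (lookup c u) * count A (c [ u ]≔ incl)
      ∑term≡ : ∑[ u < m ] term u ≡ count A c
      ∑term≡ = trans (extensions-incl kA c ic) (trans (cong (_* count A c) (m+n∸n≡m 1 j)) (*-identityˡ _))
      term≤1 : ∀ u → term u ≤ 1
      term≤1 u with lookup c u in cu
      ... | incl = z≤n
      ... | excl = z≤n
      ... | free = ≤-trans (≤-reflexive (*-identityˡ _))
                     (count-≤1 kA (c [ u ]≔ incl) (trans (#-[]≔-gain incl c u cu refl) (cong suc ic)))
      positive : ∀ u → 1 ≤ term u → lookup c u ≡ free × 1 ≤ count A (c [ u ]≔ incl)
      positive u p with lookup c u in cu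
      ... | free = refl , subst (1 ≤_) (*-identityˡ _) p
      no-two : ∀ u₁ u₂ → u₁ ≢ u₂ → 1 ≤ term u₁ → 1 ≤ term u₂ → Empty
      no-two u₁ u₂ u₁≢u₂ p₁ p₂ =
        let cu₁ , q₁ = positive u₁ p₁
            cu₂ , q₂ = positive u₂ p₂
        in 1+n≰n (≤-trans (+-mono-≤ q₁ q₂) (two-extensions≤1 c u₁ u₂ ec ic u₁≢u₂ cu₁ cu₂))

  module Agreement {F F′ : Subset m → Bool} (kF : KSets F) (kF′ : KSets F′)
                   (shadows : ∀ c → #[ excl ] c ≡ 0 → #[ incl ] c ≡ j → count F c ≡ count F′ c) where

    agree-without-excl : ∀ d c → #[ excl ] c ≡ 0 → #[ incl ] c + d ≡ j → count F c ≡ count F′ c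
    agree-without-excl zero    c ec ic = shadows c ec (trans (sym (+-identityʳ _)) ic)
    agree-without-excl (suc d) c ec ic = *-cancelˡ-≡ _ _ (suc (suc d)) (begin
      suc (suc d) * count F c   ≡⟨ cong (_* count F c) k∸i ⟨
      (suc j ∸ i) * count F c   ≡⟨ extensions-incl kF c refl ⟨
      extensions incl F c       ≡⟨ sum-cong-≗ extended ⟩
      extensions incl F′ c      ≡⟨ extensions-incl kF′ c refl ⟩
      (suc j ∸ i) * count F′ c  ≡⟨ cong (_* count F′ c) k∸i ⟩
      suc (suc d) * count F′ c  ∎)
      where
      open ≡-Reasoning
      i : ℕ
      i = #[ incl ] c
      k∸i : suc j ∸ i ≡ suc (suc d)
      k∸i = trans (cong (_∸ i) (trans (cong suc (sym ic)) (sym (+-suc i (suc d))))) (m+n∸m≡n i (suc (suc d)))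
      extended : ∀ u → is free (lookup c u) * count F (c [ u ]≔ incl) ≡ is free (lookup c u) * count F′ (c [ u ]≔ incl)
      extended u with lookup c u in cu
      ... | incl = refl
      ... | excl = refl
      ... | free = cong (1 *_) (agree-without-excl d (c [ u ]≔ incl) (trans (#-[]≔-same excl c u cu refl refl) ec)
                                  (trans (cong (_+ d) (#-[]≔-gain incl c u cu refl)) (trans (sym (+-suc i d)) ic)))

    agree-below : ∀ o c → #[ excl ] c ≡ o → #[ incl ] c + o ≤ j → count F c ≡ count F′ c
    agree-below zero    c ec le = agree-without-excl (j ∸ #[ incl ] c) c ec (m+[n∸m]≡n (≤-trans (m≤m+n _ 0) le))
    agree-below (suc o) c ec le with #-suc⇒∃ excl c ec
    ... | u , cu = +-cancelˡ-≡ (count F (c [ u ]≔ incl)) _ _ (begin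
      count F (c [ u ]≔ incl) + count F c    ≡⟨ count-split-excl F c u cu ⟨
      count F (c [ u ]≔ free)                ≡⟨ agree-below o (c [ u ]≔ free) (#excl-after c u free cu ec refl) le₀ ⟩
      count F′ (c [ u ]≔ free)               ≡⟨ count-split-excl F′ c u cu ⟩
      count F′ (c [ u ]≔ incl) + count F′ c  ≡⟨ cong (_+ count F′ c)
                                                    (agree-below o (c [ u ]≔ incl) (#excl-after c u incl cu ec refl) le₊) ⟨
      count F (c [ u ]≔ incl) + count F′ c   ∎)
      where
      open ≡-Reasoning
      le₀ : #[ incl ] (c [ u ]≔ free) + o ≤ j
      le₀ = ≤-trans (≤-reflexive (cong (_+ o) (#-[]≔-same incl c u cu refl refl))) (≤-trans (+-monoʳ-≤ _ (n≤1+n o)) le)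
      le₊ : #[ incl ] (c [ u ]≔ incl) + o ≤ j
      le₊ = ≤-trans (≤-reflexive (trans (cong (_+ o) (#-[]≔-gain incl c u cu refl)) (sym (+-suc _ o)))) le

    -- With Δ = count F − count F′, SignedAgree o c d says Δ c = (−1)^o · Δ d, stated without subtraction.
    SignedAgree : ℕ → Pattern m → Pattern m → Set
    SignedAgree zero          c d = count F c + count F′ d ≡ count F′ c + count F d
    SignedAgree (suc zero)    c d = count F c + count F d ≡ count F′ c + count F′ d
    SignedAgree (suc (suc o)) c d = SignedAgree o c d

    SignedAgree-step : ∀ o c c′ d → count F c + count F c′ ≡ count F′ c + count F′ c′ →
      SignedAgree o c′ d → SignedAgree (suc o) c d
    SignedAgree-step zero          c c′ d opp s =
      swap-difference (count F c) (count F′ c) (count F c′) (count F′ c′) (count F d) (count F′ d) opp s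
    SignedAgree-step (suc zero)    c c′ d opp s =
      swap-difference (count F c) (count F′ c) (count F c′) (count F′ c′) (count F′ d) (count F d) opp s
    SignedAgree-step (suc (suc o)) c c′ d opp s = SignedAgree-step o c c′ d opp s

    SignedAgree-odd : ∀ i c d → SignedAgree (suc (i * 2)) c d → SignedAgree 1 c d
    SignedAgree-odd zero    c d s = s
    SignedAgree-odd (suc i) c d s = SignedAgree-odd i c d s

    -- Δ vanishes on c [ u ]≔ free (below k constraints), which splits into c [ u ]≔ incl and c.
    signed-agreement : ∀ o c → #[ excl ] c ≡ o → #[ incl ] c + o ≡ suc j → SignedAgree o c (map exclToIncl c)
    signed-agreement zero    c ec _ rewrite exclToIncl-id c ec = +-comm (count F c) (count F′ c)
    signed-agreement (suc o) c ec io with #-suc⇒∃ excl c ec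
    ... | u , cu = SignedAgree-step o c c₊ (map exclToIncl c) opposite
        (subst (SignedAgree o c₊) (exclToIncl-[]≔ c u cu) (signed-agreement o c₊ (#excl-after c u incl cu ec refl) io₊))
      where
      c₀ c₊ : Pattern m
      c₀ = c [ u ]≔ free
      c₊ = c [ u ]≔ incl
      io₊ : #[ incl ] c₊ + o ≡ suc j
      io₊ = trans (cong (_+ o) (#-[]≔-gain incl c u cu refl)) (trans (sym (+-suc _ o)) io)
      io₀ : #[ incl ] c₀ + o ≡ j
      io₀ = suc-injective (trans (cong (λ i → suc (i + o)) (#-[]≔-same incl c u cu refl refl)) (trans (sym (+-suc _ o)) io))
      opposite : count F c + count F c₊ ≡ count F′ c + count F′ c₊
      opposite = begin
        count F c + count F c₊   ≡⟨ +-comm (count F c) _ ⟩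
        count F c₊ + count F c   ≡⟨ count-split-excl F c u cu ⟨
        count F c₀               ≡⟨ agree-below o c₀ (#excl-after c u free cu ec refl) (≤-reflexive io₀) ⟩
        count F′ c₀              ≡⟨ count-split-excl F′ c u cu ⟩
        count F′ c₊ + count F′ c ≡⟨ +-comm (count F′ c₊) _ ⟩
        count F′ c + count F′ c₊ ∎
        where open ≡-Reasoning

  vanishing : ∀ {F} → KSets F → (∀ c → #[ excl ] c ≡ 0 → #[ incl ] c ≡ j → count F c ≡ 0) → ∀ z → F z ≢ true
  vanishing {F} kF shadows z Fz = 1+n≰n (begin
    1                                  ≤⟨ count-point everything F z (fits-everything z) Fz ⟩
    count F everything                 ≡⟨ agree-below 0 everything (#-everything {m} excl refl) below ⟩
    count (λ _ → false) (everything {m}) ≡⟨ sumFitting-zero (everything {m}) ⟩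
    0                                  ∎)
    where
    open ≤-Reasoning
    open Agreement {F} {λ _ → false} kF (λ _ ()) (λ c ec ic → trans (shadows c ec ic) (sym (sumFitting-zero c)))
    below : #[ incl ] (everything {m}) + 0 ≤ j
    below = ≤-trans (≤-reflexive (trans (+-identityʳ _) (#-everything {m} incl refl))) z≤n

  module _ {A C : Subset m → Bool} (kA : KSets A) (kC : KSets C) (eqAC : CodeEquation A C) (eqCA : CodeEquation C A) where

    shadows-agree : ∀ c → #[ excl ] c ≡ 0 → #[ incl ] c ≡ j → count A c ≡ count C c
    shadows-agree c ec ic = bit-unique (count C (avoiding c)) (count A (avoiding c))
      (shadow≤1 kA kC eqCA c ec ic) (shadow≤1 kC kA eqAC c ec ic)
      (trans (shadow-equation kA kC eqAC c ec ic) (sym (shadow-equation kC kA eqCA c ec ic)))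

    shadows-vanish : ∀ i → j ≡ suc (i * 2) → ∀ c → #[ excl ] c ≡ 0 → #[ incl ] c ≡ j → count A c ≡ 0
    shadows-vanish i j≡ c ec ic = bit-unique (count C (avoiding c)) (2 + i) (shadow≤1 kA kC eqCA c ec ic) z≤n
      (trans (shadow-equation kA kC eqAC c ec ic) (trans (cong (3 +_) j≡) (*-comm (2 + i) 2)))

  module _ {A C : Subset m → Bool} (kA : KSets A) (kC : KSets C) (eqAC : CodeEquation A C) (eqCA : CodeEquation C A) where

    no-code-for-even-k : ∀ i → j ≡ suc (i * 2) → ∀ y → ∣ y ∣ ≡ suc j → Empty
    no-code-for-even-k i j≡ y ∣y∣ = 0≢1 (begin
      0                                  ≡⟨ cong₂ _+_ (𝟙-≢true (vanishing kA (shadows-vanish kA kC eqAC eqCA i j≡) y))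
                                                      (count-none (disjointFrom y) C λ z _ →
                                                         vanishing kC (shadows-vanish kC kA eqCA eqAC i j≡) z) ⟨
      𝟙 (A y) + count C (disjointFrom y) ≡⟨ eqAC y ∣y∣ ⟩
      1                                  ∎)
      where
      open ≡-Reasoning
      0≢1 : 0 ≢ 1
      0≢1 ()

    families-agree-for-odd-k : ∀ i → j ≡ i * 2 → ∀ y → ∣ y ∣ ≡ suc j → A y ≡ C y
    families-agree-for-odd-k i j≡ y ∣y∣ = 𝟙-injective (begin
      𝟙 (A y)    ≡⟨ count-containing kA y ∣y∣ ⟨
      count A c  ≡⟨ cross-cancel (count A c) (count C c) (count A (avoiding c)) (count C (avoiding c))
                      (trans (pattern-code-equation kA eqAC c ec ic) (sym (pattern-code-equation kC eqCA c ec ic))) signed ⟩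
      count C c  ≡⟨ count-containing kC y ∣y∣ ⟩
      𝟙 (C y)    ∎)
      where
      open ≡-Reasoning
      open Agreement kA kC (shadows-agree kA kC eqAC eqCA)
      c : Pattern m
      c = containing y
      ec : #[ excl ] c ≡ 0
      ec = #excl-containing y
      ic : #[ incl ] c ≡ suc j
      ic = trans (#incl-containing y) ∣y∣
      signed : SignedAgree 1 (avoiding c) c
      signed = SignedAgree-odd i (avoiding c) c
        (subst (λ o → SignedAgree (suc o) (avoiding c) c) j≡
          (subst (SignedAgree (suc j) (avoiding c)) (exclToIncl-avoiding c ec)
            (signed-agreement (suc j) (avoiding c) (trans (#excl-avoiding c) (trans (cong₂ _+_ ic ec) (+-identityʳ _)))
                                                   (cong (_+ suc j) (#incl-avoiding c)))))

    code-families-equal : ∀ y → ∣ y ∣ ≡ suc j → A y ≡ C y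
    code-families-equal y ∣y∣ with parity j
    ... | inj₁ (i , j≡) = families-agree-for-odd-k i j≡ y ∣y∣
    ... | inj₂ (i , j≡) = absurd (no-code-for-even-k i j≡ y ∣y∣)

-- Odd graphs

module OddGraphs (j : ℕ) where

  O DO : Graph
  O  = OddGraph (suc (suc j))
  DO = DoubledOddGraph (suc (suc j))

  O² : Graph
  O² = BipartiteDouble O

  N : ℕ
  N = ground (suc (suc j))

  N≡ : N ≡ 3 + (j + j)
  N≡ = cong suc (solve 1 (λ j → j :+ (con 2 :+ (j :+ con 0)) := con 2 :+ (j :+ j)) refl j)

  open KSetFamilies j N N≡

  k≢k+1 : suc j ≢ suc (suc j)
  k≢k+1 e = 1+n≢n (sym (suc-injective e))

  ∣∁∣-shrinks : ∀ (p : Subset N) → ∣ p ∣ ≡ suc (suc j) → ∣ ∁ p ∣ ≡ suc j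
  ∣∁∣-shrinks p e = trans (∣∁p∣≡n∸∣p∣ p) (trans (cong₂ _∸_ N≡ e) (m+n∸n≡m (suc j) j))

  ∣∁∣-grows : ∀ (p : Subset N) → ∣ p ∣ ≡ suc j → ∣ ∁ p ∣ ≡ suc (suc j)
  ∣∁∣-grows p e = trans (∣∁p∣≡n∸∣p∣ p) (trans (cong₂ _∸_ N≡ e) (m+n∸n≡m (suc (suc j)) j))

  O-vertex-≡ : ∀ {p q : Subset N} (e : ∣ p ∣ ≡ suc j) (e′ : ∣ q ∣ ≡ suc j) → p ≡ q → _≡_ {A = V O} (p , e) (q , e′)
  O-vertex-≡ e e′ refl = cong (_ ,_) (≡-irrelevant e e′)

  DO-inj₂-≡ : ∀ {p q : Subset N} (e : ∣ p ∣ ≡ suc (suc j)) (e′ : ∣ q ∣ ≡ suc (suc j)) → p ≡ q →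
    _≡_ {A = V DO} (p , inj₂ e) (q , inj₂ e′)
  DO-inj₂-≡ e e′ refl = cong (λ x → _ , inj₂ x) (≡-irrelevant e e′)

  O-loopless : Loopless O
  O-loopless (p , e) p∩p≡⊥ = 1+n≢0 (trans (sym e) (trans (cong ∣_∣ (trans (sym (∩-idem p)) p∩p≡⊥)) (∣⊥∣≡0 N)))

  DO≅O² : DO ≅ O²
  DO≅O² = record { to = to ; from = from ; from∘to = from∘to ; to∘from = to∘from
                 ; to-adj = λ {u v} → to-adj {u} {v} ; from-adj = λ {x y} → from-adj {x} {y} }
    where
    to : V DO → V O²
    to (p , inj₁ e) = (p , e) , false
    to (p , inj₂ e) = (∁ p , ∣∁∣-shrinks p e) , true
    from : V O² → V DO
    from ((p , e) , false) = p , inj₁ e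
    from ((p , e) , true)  = ∁ p , inj₂ (∣∁∣-grows p e)
    from∘to : ∀ v → from (to v) ≡ v
    from∘to (p , inj₁ e) = refl
    from∘to (p , inj₂ e) = DO-inj₂-≡ _ e (∁-involutive p)
    to∘from : ∀ w → to (from w) ≡ w
    to∘from ((p , e) , false) = refl
    to∘from ((p , e) , true)  = cong (_, true) (O-vertex-≡ _ e (∁-involutive p))
    to-adj : ∀ {u v} → Adj DO u v → Adj O² (to u) (to v)
    to-adj {p , inj₁ e} {q , inj₂ e′} (inj₁ (_ , _ , p⊆q)) = ⊆⇒∩∁≡⊥ p⊆q , refl
    to-adj {p , inj₂ e} {q , inj₁ e′} (inj₂ (_ , _ , q⊆p)) = trans (∩-comm (∁ p) q) (⊆⇒∩∁≡⊥ q⊆p) , refl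
    to-adj {p , inj₁ e} {q , inj₁ e′} (inj₁ (_ , q₊ , _)) = absurd (k≢k+1 (trans (sym e′) q₊))
    to-adj {p , inj₁ e} {q , inj₁ e′} (inj₂ (_ , p₊ , _)) = absurd (k≢k+1 (trans (sym e) p₊))
    to-adj {p , inj₁ e} {q , inj₂ e′} (inj₂ (_ , p₊ , _)) = absurd (k≢k+1 (trans (sym e) p₊))
    to-adj {p , inj₂ e} {q , inj₁ e′} (inj₁ (p₋ , _ , _)) = absurd (k≢k+1 (trans (sym p₋) e))
    to-adj {p , inj₂ e} {q , inj₂ e′} (inj₁ (p₋ , _ , _)) = absurd (k≢k+1 (trans (sym p₋) e))
    to-adj {p , inj₂ e} {q , inj₂ e′} (inj₂ (q₋ , _ , _)) = absurd (k≢k+1 (trans (sym q₋) e′))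
    from-adj : ∀ {x y} → Adj O² x y → Adj DO (from x) (from y)
    from-adj {(p , e) , false} {(q , e′) , true}  (p∩q , _) = inj₁ (e , ∣∁∣-grows q e′ , ∩≡⊥⇒⊆∁ p∩q)
    from-adj {(p , e) , true}  {(q , e′) , false} (p∩q , _) = inj₂ (e′ , ∣∁∣-grows p e , ∩≡⊥⇒⊆∁ (trans (∩-comm q p) p∩q))

  module _ (D : V O² → Set) (D? : ∀ v → Dec (D v))
           (cover : ∀ v → ∃ λ c → D c × InClosedNbhd O² c v)
           (unique : ∀ c c′ v → D c → D c′ → InClosedNbhd O² c v → InClosedNbhd O² c′ v → c ≡ c′) where

    layer : Bool → Subset N → Bool
    layer b y with ∣ y ∣ ≟ suc j
    ... | yes e = does (D? ((y , e) , b))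
    ... | no _  = false

    layer-sound : ∀ b y → layer b y ≡ true → ∃ λ e → D ((y , e) , b)
    layer-sound b y L with ∣ y ∣ ≟ suc j
    ... | yes e with D? ((y , e) , b)
    ...   | yes Dy = e , Dy

    layer-complete : ∀ b y e → D ((y , e) , b) → layer b y ≡ true
    layer-complete b y e Dy with ∣ y ∣ ≟ suc j
    ... | no ¬e = absurd (¬e e)
    ... | yes e′ with D? ((y , e′) , b)
    ...   | yes _   = refl
    ...   | no ¬Dy = absurd (¬Dy (subst (λ v → D (v , b)) (O-vertex-≡ e e′ refl) Dy))

    layer-KSets : ∀ b → KSets (layer b)
    layer-KSets b y L = proj₁ (layer-sound b y L)

    code-neighbour : ∀ b y ∣y∣ z → fits (disjointFrom y) z ≡ true → layer (not b) z ≡ true →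
      ∃ λ ez → D ((z , ez) , not b) × InClosedNbhd O² ((z , ez) , not b) ((y , ∣y∣) , b)
    code-neighbour b y ∣y∣ z yz L =
      let ez , Dz = layer-sound (not b) z L in ez , Dz , inj₂ (fits-disjointFrom⇒ y z yz , sym (not-involutive b))

    no-code-neighbour : ∀ b y ∣y∣ → D ((y , ∣y∣) , b) → count (layer (not b)) (disjointFrom y) ≡ 0
    no-code-neighbour b y ∣y∣ Dy = count-none (disjointFrom y) (layer (not b)) λ z yz L →
      let ez , Dz , z∼y = code-neighbour b y ∣y∣ z yz L
      in not-¬ {b} refl (sym (cong proj₂ (unique _ _ ((y , ∣y∣) , b) Dz Dy z∼y (inj₁ refl))))

    one-code-neighbour : ∀ b y ∣y∣ → ¬ D ((y , ∣y∣) , b) → count (layer (not b)) (disjointFrom y) ≡ 1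
    one-code-neighbour b y ∣y∣ ¬Dy with cover ((y , ∣y∣) , b)
    ... | w , Dw , inj₁ w≡y = absurd (¬Dy (subst D w≡y Dw))
    ... | ((z , ez) , b′) , Dw , inj₂ (z∩y , b≡not-b′) =
      ≤-antisym (≤-trans (count-≤-𝟙 (disjointFrom y) (layer (not b)) z only) (𝟙≤1 _))
                (count-point (disjointFrom y) (layer (not b)) z (fits-disjointFrom⇐ y z z∩y)
                             (layer-complete (not b) z ez (subst (λ x → D ((z , ez) , x)) b′≡not-b Dw)))
      where
      b′≡not-b : b′ ≡ not b
      b′≡not-b = trans (sym (not-involutive b′)) (cong not (sym b≡not-b′))
      only : ∀ z′ → fits (disjointFrom y) z′ ≡ true → layer (not b) z′ ≡ true → z′ ≡ z
      only z′ yz′ L = let ez′ , Dz′ , z′∼y = code-neighbour b y ∣y∣ z′ yz′ L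
                      in cong (proj₁ ∘ proj₁) (unique _ _ ((y , ∣y∣) , b) Dz′ Dw z′∼y (inj₂ (z∩y , b≡not-b′)))

    layer-equation : ∀ b → CodeEquation (layer b) (layer (not b))
    layer-equation b y ∣y∣ with D? ((y , ∣y∣) , b)
    ... | yes Dy = cong₂ _+_ (cong 𝟙 (layer-complete b y ∣y∣ Dy)) (no-code-neighbour b y ∣y∣ Dy)
    ... | no ¬Dy = cong₂ _+_
      (𝟙-≢true λ L → ¬Dy (subst (λ v → D (v , b)) (O-vertex-≡ _ ∣y∣ refl) (proj₂ (layer-sound b y L))))
      (one-code-neighbour b y ∣y∣ ¬Dy)

    swap-invariant : ∀ v b → D (v , b) → D (v , not b)
    swap-invariant (y , e) b Dy =
      let e′ , Dy′ = layer-sound (not b) y (trans (sym (layers-agree b)) (layer-complete b y e Dy))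
      in subst (λ v → D (v , not b)) (O-vertex-≡ e′ e refl) Dy′
      where
      layers-agree : ∀ b → layer b y ≡ layer (not b) y
      layers-agree false =
        code-families-equal (layer-KSets false) (layer-KSets true) (layer-equation false) (layer-equation true) y e
      layers-agree true  = sym (layers-agree false)

corollary3p4 : (n : ℕ) → 2 ≤ n →
    (HasPerfect1Code (DoubledOddGraph n) → HasPerfect1Code (OddGraph n))
    × (HasPerfect1Code (OddGraph n) → HasPerfect1Code (DoubledOddGraph n))
corollary3p4 (suc zero)    (s≤s ())
corollary3p4 (suc (suc j)) _ = DO⇒O , O⇒DO
  where
  open OddGraphs j
  DO⇒O : HasPerfect1Code DO → HasPerfect1Code O
  DO⇒O code with transfer DO≅O² code
  ... | D , isCode@(cover , unique) = project-code D isCode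
    (swap-invariant D (perfect-code-decidable (BipartiteDouble-loopless O) isCode) cover unique)
  O⇒DO : HasPerfect1Code O → HasPerfect1Code DO
  O⇒DO code = transfer (≅-sym DO≅O²) (lift-code O-loopless code)
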